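{- If $G$ is a nearly 4-edge-connected graph, then there exist a tree $T$ and a partition $\{X_t:t\in V(T)\}$ of $V(G)$ such that: (1) for every $t\in V(T)$, $G[X_t]$ either consists of a single vertex or is 4-edge-connected; (2) if some edge of $G$ has one end in $X_{t_1}$ and one end in $X_{t_2}$ for distinct $t_1,t_2\in V(T)$, then $t_1$ is adjacent to $t_2$ in $T$; (3) for every edge $t_1t_2$ of $T$, there are at most three edges of $G$ with one end in $X_{t_1}$ and one end in $X_{t_2}$, and these edges are parallel edges with the same ends.
   Context: Graphs are finite and may have loops and parallel edges. An edge-cut of $G$ is an ordered partition $[A,B]$ of $V(G)$ (parts may be empty), of order equal to the number of edges with one end in $A$ and one in $B$. A graph is 4-edge-connected if it has at least two vertices and remains connected after deleting any set of fewer than four edges. $G$ is nearly 4-edge-connected if it is connected and for every edge-cut $[A,B]$ of order less than four, all edges between $A$ and $B$ are parallel edges with the same pair of ends. $G[X]$ is the subgraph induced by $X$. -}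

module Defs where

open import Data.Nat using (ℕ; zero; suc; _≤_; _<_)
open import Data.Fin using (Fin; zero; suc; _≟_; inject₁; fromℕ)
open import Data.Unit using (⊤)
open import Data.Bool using (Bool; true; false; _xor_; _∧_; _∨_)
open import Data.Product using (Σ; ∃; ∃-syntax; _×_; _,_; proj₁; proj₂; swap)
open import Data.Sum using (_⊎_)
open import Data.List using (List; length; filterᵇ; allFin)
open import Data.List.Membership.Propositional using (_∈_)
open import Data.Empty using (⊥)
open import Relation.Nullary using (¬_)
open import Relation.Nullary.Decidable using (⌊_⌋)
open import Relation.Binary.PropositionalEquality using (_≡_; _≢_)
open import Function.Definitions using (Injective)

-- A finite multigraph (loops and parallel edges allowed):
-- vertices Fin V, edges Fin E, each edge has a (ordered, but only used
-- up to swapping) pair of ends.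
record Graph : Set where
  field
    V : ℕ
    E : ℕ
    ends : Fin E → Fin V × Fin V
open Graph public

Joins : (G : Graph) → Fin (E G) → Fin (V G) → Fin (V G) → Set
Joins G e u v = (ends G e ≡ (u , v)) ⊎ (ends G e ≡ (v , u))

SameEnds : (G : Graph) → Fin (E G) → Fin (E G) → Set
SameEnds G e f = (ends G e ≡ ends G f) ⊎ (ends G e ≡ swap (ends G f))

data Reach (G : Graph) (ok : Fin (E G) → Set) : Fin (V G) → Fin (V G) → Set where
  here : ∀ {u} → Reach G ok u u
  step : ∀ {u w v} (e : Fin (E G)) → ok e → Joins G e u w → Reach G ok w v → Reach G ok u v

-- The subgraph with vertex set {v | X v} and edge set {e | ok e}
-- (edges in `ok` are assumed to have both ends in X) is connected:
-- it has a vertex and any two of its vertices are joined by a walk in it.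
ConnectedSub : (G : Graph) → (Fin (V G) → Set) → (Fin (E G) → Set) → Set
ConnectedSub G X ok = (∃[ v ] X v) × (∀ u v → X u → X v → Reach G ok u v)

Connected : Graph → Set
Connected G = ConnectedSub G (λ _ → ⊤) (λ _ → ⊤)

InsideX : (G : Graph) → (Fin (V G) → Set) → Fin (E G) → Set
InsideX G X e = X (proj₁ (ends G e)) × X (proj₂ (ends G e))

FourEdgeConnectedInduced : (G : Graph) → (Fin (V G) → Set) → Set
FourEdgeConnectedInduced G X =
  (∃[ u ] ∃[ v ] (u ≢ v × X u × X v)) ×
  ((S : List (Fin (E G))) → length S < 4 →
     ConnectedSub G X (λ e → InsideX G X e × ¬ (e ∈ S)))

FourEdgeConnected : Graph → Set
FourEdgeConnected G = FourEdgeConnectedInduced G (λ _ → ⊤)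

SingleVertex : (G : Graph) → (Fin (V G) → Set) → Set
SingleVertex G X = ∃[ v ] (∀ u → (X u → u ≡ v) × (u ≡ v → X u))

-- edge-cut [A,B], A given by its characteristic function, B its complement
crosses : (G : Graph) → (Fin (V G) → Bool) → Fin (E G) → Bool
crosses G A e = A (proj₁ (ends G e)) xor A (proj₂ (ends G e))

cutOrder : (G : Graph) → (Fin (V G) → Bool) → ℕ
cutOrder G A = length (filterᵇ (crosses G A) (allFin (E G)))

NearlyFourEdgeConnected : Graph → Set
NearlyFourEdgeConnected G =
  Connected G ×
  ((A : Fin (V G) → Bool) → cutOrder G A < 4 →
     ∀ e f → crosses G A e ≡ true → crosses G A f ≡ true → SameEnds G e f)

-- A cycle of length l+1 ≥ 1: distinct vertices v_0..v_l and distinct edges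
-- e_0..e_l where e_i joins v_i and v_{i+1} (indices mod l+1).
-- (l = 0: a loop; l = 1: two parallel edges.)
record Cycle (G : Graph) : Set where
  field
    len : ℕ
    vs : Fin (suc len) → Fin (V G)
    es : Fin (suc len) → Fin (E G)
    vs-inj : Injective _≡_ _≡_ vs
    es-inj : Injective _≡_ _≡_ es
    consec : (i : Fin len) → Joins G (es (inject₁ i)) (vs (inject₁ i)) (vs (suc i))
    close : Joins G (es (fromℕ len)) (vs (fromℕ len)) (vs zero)

IsTree : Graph → Set
IsTree T = Connected T × ¬ Cycle T

Adjacent : (T : Graph) → Fin (V T) → Fin (V T) → Set
Adjacent T t1 t2 = ∃[ d ] Joins T d t1 t2

between : (G : Graph) {k : ℕ} → (Fin (V G) → Fin k) → Fin k → Fin k → Fin (E G) → Bool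
between G f t1 t2 e =
  (⌊ f (proj₁ (ends G e)) ≟ t1 ⌋ ∧ ⌊ f (proj₂ (ends G e)) ≟ t2 ⌋) ∨
  (⌊ f (proj₁ (ends G e)) ≟ t2 ⌋ ∧ ⌊ f (proj₂ (ends G e)) ≟ t1 ⌋)

numBetween : (G : Graph) {k : ℕ} → (Fin (V G) → Fin k) → Fin k → Fin k → ℕ
numBetween G f t1 t2 = length (filterᵇ (between G f t1 t2) (allFin (E G)))

-- The tree-decomposition conclusion: the partition {X_t} is given by
-- f : V(G) → V(T), X_t = {v | f v ≡ t}.
TreePartition : (G : Graph) (T : Graph) → (Fin (V G) → Fin (V T)) → Set
TreePartition G T f =
  ((t : Fin (V T)) → SingleVertex G (λ v → f v ≡ t)
                   ⊎ FourEdgeConnectedInduced G (λ v → f v ≡ t)) ×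
  ((e : Fin (E G)) → f (proj₁ (ends G e)) ≢ f (proj₂ (ends G e)) →
     Adjacent T (f (proj₁ (ends G e))) (f (proj₂ (ends G e)))) ×
  ((d : Fin (E T)) →
     numBetween G f (proj₁ (ends T d)) (proj₂ (ends T d)) ≤ 3 ×
     (∀ e e' → between G f (proj₁ (ends T d)) (proj₂ (ends T d)) e ≡ true
             → between G f (proj₁ (ends T d)) (proj₂ (ends T d)) e' ≡ true
             → SameEnds G e e'))

module Submission where

-- Call an edge thin if its bundle of parallel edges has at most three members and its ends
-- are not joined by any walk avoiding that bundle. The parts X_t are the components of G
-- minus its thin edges, and T has one edge for each thin bundle. Parts are joined only
-- through thin bundles, and T is acyclic because going around a cycle of T would join the
-- ends of a thin bundle while avoiding it. If deleting a set S of fewer than four edges of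
-- G[X_t] separated u from v, then u's component, together with everything hanging off it
-- behind thin bundles, is the side of an edge-cut of G crossed only by edges of S; by near
-- 4-edge-connectivity these form one bundle, which is then thin although it lies inside X_t.

open import Defs
open import Data.Bool using (Bool; true; false; _xor_)
import Data.Bool as Bool
open import Data.Bool.Properties using (T-≡; T-∧; T-∨; xor-same)
open import Data.Empty using (⊥; ⊥-elim)
open import Data.Fin using (Fin; zero; suc; _≟_; inject₁; fromℕ)
import Data.Fin as Fin
open import Data.Fin.Induction using (<-weakInduction)
open import Data.Fin.Properties using (any?; pigeonhole; <-cmp; fromℕ≢inject₁)
open import Data.List using (List; []; _∷_; length; filter; filterᵇ; allFin; lookup; deduplicate)
open import Data.List.Membership.Propositional using (_∈_)
open import Data.List.Membership.Propositional.Properties using (∈-allFin; ∈-filter⁺; ∈-filter⁻; ∈-lookup)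
open import Data.List.Relation.Unary.All as All using ()
open import Data.List.Relation.Unary.AllPairs using (AllPairs; _∷_)
open import Data.List.Relation.Unary.Any as Any using (Any; here; there)
open import Data.List.Relation.Unary.Any.Properties as Anyₚ using (lookup-index)
open import Data.List.Relation.Unary.Unique.DecSetoid.Properties using (deduplicate-!)
open import Data.List.Relation.Unary.Unique.Propositional.Properties as Uniqueₚ using (allFin⁺)
open import Data.Nat using (ℕ; suc; _≤_; _<_; s≤s; _≤?_)
open import Data.Nat.Properties using (≮⇒≥; ≤-trans; ≤-pred; ≤-<-trans)
open import Data.Product using (∃-syntax; _×_; _,_; proj₁; proj₂; swap)
open import Data.Product.Properties using (≡-dec)
open import Data.Sum using (_⊎_; inj₁; inj₂)
open import Data.Unit using (⊤; tt)
open import Function using (_∘_; Equivalence; mk⇔)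
open import Level using (0ℓ)
open import Relation.Binary using (Rel; IsDecEquivalence; tri<; tri≈; tri>)
open import Relation.Binary.PropositionalEquality using (_≡_; _≢_; refl; sym; trans; cong; subst; subst₂; module ≡-Reasoning)
open import Relation.Nullary using (¬_; Dec; yes; no)
open import Relation.Nullary.Decidable
  using (⌊_⌋; map′; _×-dec_; _⊎-dec_; ¬?; toWitness; fromWitness; isYes≗does; does-⇔; dec-true; dec-false; decidable-stable)
open import Relation.Nullary.Decidable.Core using (T?)
open import Relation.Unary using (Pred; Decidable)

module Walks (G : Graph) where

  Joins-sym : ∀ {e u v} → Joins G e u v → Joins G e v u
  Joins-sym (inj₁ eq) = inj₂ eq
  Joins-sym (inj₂ eq) = inj₁ eq

  Reach-map : ∀ {ok ok′ : Pred (Fin (E G)) 0ℓ} → (∀ {e} → ok e → ok′ e) →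
              ∀ {u v} → Reach G ok u v → Reach G ok′ u v
  Reach-map f here = here
  Reach-map f (step e o j r) = step e (f o) j (Reach-map f r)

  Reach-trans : ∀ {ok u w v} → Reach G ok u w → Reach G ok w v → Reach G ok u v
  Reach-trans here r′ = r′
  Reach-trans (step e o j r) r′ = step e o j (Reach-trans r r′)

  Reach-edge : ∀ {ok : Pred (Fin (E G)) 0ℓ} {u v} e → ok e → Joins G e u v → Reach G ok u v
  Reach-edge e o j = step e o j here

  Reach-sym : ∀ {ok u v} → Reach G ok u v → Reach G ok v u
  Reach-sym here = here
  Reach-sym (step e o j r) = Reach-trans (Reach-sym r) (Reach-edge e o (Joins-sym j))

  private
    ReachIn : List (Fin (E G)) → Rel (Fin (V G)) 0ℓ
    ReachIn L = Reach G (_∈ L)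

    -- A walk along g ∷ L, where g joins p and q, can be shortened to use g at most once.
    ReachVia : List (Fin (E G)) → (p q u v : Fin (V G)) → Set
    ReachVia L p q u v = ReachIn L u v ⊎ (ReachIn L u p × ReachIn L q v) ⊎ (ReachIn L u q × ReachIn L p v)

    ReachVia-swap : ∀ {L p q u v} → ReachVia L p q u v → ReachVia L q p u v
    ReachVia-swap (inj₁ r) = inj₁ r
    ReachVia-swap (inj₂ (inj₁ r)) = inj₂ (inj₂ r)
    ReachVia-swap (inj₂ (inj₂ r)) = inj₂ (inj₁ r)

    ReachVia-jump : ∀ {L p q v} → ReachVia L p q q v → ReachVia L p q p v
    ReachVia-jump (inj₁ r) = inj₂ (inj₁ (here , r))
    ReachVia-jump (inj₂ (inj₁ (_ , r))) = inj₂ (inj₁ (here , r))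
    ReachVia-jump (inj₂ (inj₂ (_ , r))) = inj₁ r

    ReachVia-prepend : ∀ {L p q u w v} → ReachIn L u w → ReachVia L p q w v → ReachVia L p q u v
    ReachVia-prepend r (inj₁ r′) = inj₁ (Reach-trans r r′)
    ReachVia-prepend r (inj₂ (inj₁ (r₁ , r₂))) = inj₂ (inj₁ (Reach-trans r r₁ , r₂))
    ReachVia-prepend r (inj₂ (inj₂ (r₁ , r₂))) = inj₂ (inj₂ (Reach-trans r r₁ , r₂))

    ReachIn-∷⁻ : ∀ {L} g {u v} → ReachIn (g ∷ L) u v →
                 ReachVia L (proj₁ (ends G g)) (proj₂ (ends G g)) u v
    ReachIn-∷⁻ g here = inj₁ here
    ReachIn-∷⁻ g (step e (there e∈L) j r) = ReachVia-prepend (Reach-edge e e∈L j) (ReachIn-∷⁻ g r)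
    ReachIn-∷⁻ g (step e (here refl) (inj₁ refl) r) = ReachVia-jump (ReachIn-∷⁻ g r)
    ReachIn-∷⁻ g (step e (here refl) (inj₂ refl) r) = ReachVia-swap (ReachVia-jump (ReachVia-swap (ReachIn-∷⁻ g r)))

    ReachIn-∷⁺ : ∀ {L} g {u v} → ReachVia L (proj₁ (ends G g)) (proj₂ (ends G g)) u v → ReachIn (g ∷ L) u v
    ReachIn-∷⁺ g (inj₁ r) = Reach-map there r
    ReachIn-∷⁺ g (inj₂ (inj₁ (r₁ , r₂))) = Reach-trans (Reach-map there r₁) (step g (here refl) (inj₁ refl) (Reach-map there r₂))
    ReachIn-∷⁺ g (inj₂ (inj₂ (r₁ , r₂))) = Reach-trans (Reach-map there r₁) (step g (here refl) (inj₂ refl) (Reach-map there r₂))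

    reachIn? : ∀ L u v → Dec (ReachIn L u v)
    reachIn? [] u v = map′ (λ { refl → here }) (λ { here → refl }) (u ≟ v)
    reachIn? (g ∷ L) u v = map′ (ReachIn-∷⁺ g) (ReachIn-∷⁻ g)
      (reachIn? L u v ⊎-dec (reachIn? L u p ×-dec reachIn? L q v) ⊎-dec (reachIn? L u q ×-dec reachIn? L p v))
      where
      p = proj₁ (ends G g)
      q = proj₂ (ends G g)

  reach? : {ok : Pred (Fin (E G)) 0ℓ} → Decidable ok → ∀ u v → Dec (Reach G ok u v)
  reach? ok? u v = map′ (Reach-map (proj₂ ∘ ∈-filter⁻ ok? {xs = allFin _})) (Reach-map (∈-filter⁺ ok? (∈-allFin _)))
    (reachIn? (filter ok? (allFin (E G))) u v)

AllPairs-lookup : ∀ {A : Set} {R : Rel A 0ℓ} {xs : List A} → AllPairs R xs →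
                  ∀ {i j} → i Fin.< j → R (lookup xs i) (lookup xs j)
AllPairs-lookup (Rx ∷ _) {zero} {suc j} _ = All.lookup Rx (∈-lookup j)
AllPairs-lookup (_ ∷ Rxs) {suc i} {suc j} (s≤s i<j) = AllPairs-lookup Rxs i<j

Unique-⊆⇒length-≤ : ∀ {A : Set} {xs ys : List A} → AllPairs _≢_ xs →
                    (∀ {x} → x ∈ xs → x ∈ ys) → length xs ≤ length ys
Unique-⊆⇒length-≤ {xs = xs} {ys} distinct xs⊆ys = ≮⇒≥ λ ys<xs →
  let i , j , i<j , same = pigeonhole ys<xs positionInYs in
  AllPairs-lookup distinct i<j (begin
    lookup xs i                 ≡⟨ lookup-index (xs⊆ys (∈-lookup i)) ⟩
    lookup ys (positionInYs i)  ≡⟨ cong (lookup ys) same ⟩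
    lookup ys (positionInYs j)  ≡⟨ lookup-index (xs⊆ys (∈-lookup j)) ⟨
    lookup xs j                 ∎)
  where
  open ≡-Reasoning
  positionInYs : Fin (length xs) → Fin (length ys)
  positionInYs i = Any.index (xs⊆ys (∈-lookup i))

-- One representative of each ≈-class meeting P, the classes being numbered by Fin size.
record Transversal {n} (P : Pred (Fin n) 0ℓ) (_≈_ : Rel (Fin n) 0ℓ) : Set where
  field
    size : ℕ
    rep : Fin size → Fin n
    rep-P : ∀ t → P (rep t)
    rep-injective : ∀ {t t′} → rep t ≈ rep t′ → t ≡ t′
    index : ∀ x → P x → Fin size
    ≈-rep-index : ∀ x (p : P x) → x ≈ rep (index x p)

-- Opaque, since unfolding the deduplicated list makes unification below explode.
opaque
  transversal : ∀ {n} {P : Pred (Fin n) 0ℓ} {_≈_ : Rel (Fin n) 0ℓ} →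
                Decidable P → IsDecEquivalence _≈_ → Transversal P _≈_
  transversal {n} {P} {_≈_} P? isDecEq = record
    { size = length reps
    ; rep = lookup reps
    ; rep-P = rep-P
    ; rep-injective = rep-injective
    ; index = index
    ; ≈-rep-index = ≈-rep-index
    }
    where
    open IsDecEquivalence isDecEq using (reflexive) renaming (_≟_ to _≟ᵉ_; sym to ≈-sym; trans to ≈-trans)
    reps : List (Fin n)
    reps = deduplicate _≟ᵉ_ (filter P? (allFin n))
    reps-distinct : AllPairs (λ x y → ¬ x ≈ y) reps
    reps-distinct = deduplicate-! (record { isDecEquivalence = isDecEq }) (filter P? (allFin n))
    rep-P : ∀ t → P (lookup reps t)
    rep-P t = proj₂ (∈-filter⁻ P? {xs = allFin n} (Anyₚ.deduplicate⁻ _≟ᵉ_ (∈-lookup {xs = reps} t)))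
    rep-injective : ∀ {t t′} → lookup reps t ≈ lookup reps t′ → t ≡ t′
    rep-injective {t} {t′} t≈t′ with <-cmp t t′
    ... | tri< t<t′ _ _ = ⊥-elim (AllPairs-lookup reps-distinct t<t′ t≈t′)
    ... | tri≈ _ t≡t′ _ = t≡t′
    ... | tri> _ _ t′<t = ⊥-elim (AllPairs-lookup reps-distinct t′<t (≈-sym t≈t′))
    class : ∀ {x} → P x → Any (x ≈_) reps
    class {x} p = Anyₚ.deduplicate⁺ _≟ᵉ_ (λ b≈a x≈a → ≈-trans x≈a (≈-sym b≈a))
      (Any.map reflexive (∈-filter⁺ P? (∈-allFin x) p))
    index : ∀ x → P x → Fin (length reps)
    index x p = Any.index (class p)
    ≈-rep-index : ∀ x (p : P x) → x ≈ lookup reps (index x p)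
    ≈-rep-index x p = lookup-index (class p)

count-≤ : ∀ {n} (p : Fin n → Bool) {ys : List (Fin n)} → (∀ i → p i ≡ true → i ∈ ys) →
          length (filterᵇ p (allFin n)) ≤ length ys
count-≤ {n} p sub = Unique-⊆⇒length-≤ (Uniqueₚ.filter⁺ (T? ∘ p) (allFin⁺ n))
  (λ i∈ → sub _ (Equivalence.to T-≡ (proj₂ (∈-filter⁻ (T? ∘ p) {xs = allFin n} i∈))))

count-mono : ∀ {n} (p q : Fin n → Bool) → (∀ i → p i ≡ true → q i ≡ true) →
             length (filterᵇ p (allFin n)) ≤ length (filterᵇ q (allFin n))
count-mono p q p⇒q = count-≤ p (λ i pi → ∈-filter⁺ (T? ∘ q) (∈-allFin i) (Equivalence.from T-≡ (p⇒q i pi)))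

≢⇒xor≡true : ∀ {x y} → x ≢ y → x xor y ≡ true
≢⇒xor≡true {true} {true} x≢y = ⊥-elim (x≢y refl)
≢⇒xor≡true {true} {false} _ = refl
≢⇒xor≡true {false} {true} _ = refl
≢⇒xor≡true {false} {false} x≢y = ⊥-elim (x≢y refl)

xor≡true⇒≢ : ∀ {x y} → x xor y ≡ true → x ≢ y
xor≡true⇒≢ {x} x⊕x≡true refl with () ← trans (sym x⊕x≡true) (xor-same x)

module Bundles (G : Graph) where
  open Walks G

  end₁ end₂ : Fin (E G) → Fin (V G)
  end₁ e = proj₁ (ends G e)
  end₂ e = proj₂ (ends G e)

  Joins-ends : ∀ e → Joins G e (end₁ e) (end₂ e)
  Joins-ends e = inj₁ refl

  Joins⁻ : ∀ {e x y} → Joins G e x y → (x ≡ end₁ e × y ≡ end₂ e) ⊎ (x ≡ end₂ e × y ≡ end₁ e)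
  Joins⁻ (inj₁ refl) = inj₁ (refl , refl)
  Joins⁻ (inj₂ refl) = inj₂ (refl , refl)

  joins? : ∀ e x y → Dec (Joins G e x y)
  joins? e x y = ≡-dec _≟_ _≟_ (ends G e) (x , y) ⊎-dec ≡-dec _≟_ _≟_ (ends G e) (y , x)

  Joins-unique : ∀ {e x y a b} → Joins G e x y → Joins G e a b → (x ≡ a × y ≡ b) ⊎ (x ≡ b × y ≡ a)
  Joins-unique j j′ with Joins⁻ j | Joins⁻ j′
  ... | inj₁ (refl , refl) | inj₁ (refl , refl) = inj₁ (refl , refl)
  ... | inj₁ (refl , refl) | inj₂ (refl , refl) = inj₂ (refl , refl)
  ... | inj₂ (refl , refl) | inj₁ (refl , refl) = inj₂ (refl , refl)
  ... | inj₂ (refl , refl) | inj₂ (refl , refl) = inj₁ (refl , refl)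

  InsideX-Joins : ∀ {X e x y} → Joins G e x y → X x → X y → InsideX G X e
  InsideX-Joins j Xx Xy with Joins⁻ j
  ... | inj₁ (refl , refl) = Xx , Xy
  ... | inj₂ (refl , refl) = Xy , Xx

  SameEnds-sym : ∀ {e g} → SameEnds G e g → SameEnds G g e
  SameEnds-sym (inj₁ eq) = inj₁ (sym eq)
  SameEnds-sym (inj₂ eq) = inj₂ (cong swap (sym eq))

  SameEnds-trans : ∀ {e g h} → SameEnds G e g → SameEnds G g h → SameEnds G e h
  SameEnds-trans (inj₁ eq) (inj₁ eq′) = inj₁ (trans eq eq′)
  SameEnds-trans (inj₁ eq) (inj₂ eq′) = inj₂ (trans eq eq′)
  SameEnds-trans (inj₂ eq) (inj₁ eq′) = inj₂ (trans eq (cong swap eq′))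
  SameEnds-trans (inj₂ eq) (inj₂ eq′) = inj₁ (trans eq (cong swap eq′))

  sameEnds? : ∀ e g → Dec (SameEnds G e g)
  sameEnds? e g = ≡-dec _≟_ _≟_ (ends G e) (ends G g) ⊎-dec ≡-dec _≟_ _≟_ (ends G e) (swap (ends G g))

  SameEnds-isDecEquivalence : IsDecEquivalence (SameEnds G)
  SameEnds-isDecEquivalence = record
    { isEquivalence = record { refl = inj₁ refl ; sym = SameEnds-sym ; trans = SameEnds-trans }
    ; _≟_ = sameEnds?
    }

  Joins-resp-SameEnds : ∀ {e g x y} → SameEnds G e g → Joins G e x y → Joins G g x y
  Joins-resp-SameEnds (inj₁ eq) (inj₁ j) = inj₁ (trans (sym eq) j)
  Joins-resp-SameEnds (inj₁ eq) (inj₂ j) = inj₂ (trans (sym eq) j)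
  Joins-resp-SameEnds (inj₂ eq) (inj₁ j) = inj₂ (cong swap (trans (sym eq) j))
  Joins-resp-SameEnds (inj₂ eq) (inj₂ j) = inj₁ (cong swap (trans (sym eq) j))

  crosses-Joins : ∀ A {e x y} → Joins G e x y → A x ≢ A y → crosses G A e ≡ true
  crosses-Joins A j Ax≢Ay with Joins⁻ j
  ... | inj₁ (refl , refl) = ≢⇒xor≡true Ax≢Ay
  ... | inj₂ (refl , refl) = ≢⇒xor≡true (Ax≢Ay ∘ sym)

  crosses-resp-SameEnds : ∀ A {e g} → SameEnds G e g → crosses G A e ≡ true → crosses G A g ≡ true
  crosses-resp-SameEnds A e∥g e-crosses =
    crosses-Joins A (Joins-resp-SameEnds e∥g (Joins-ends _)) (xor≡true⇒≢ e-crosses)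

  Reach-crosses : ∀ A {ok x y} → Reach G ok x y → A x ≢ A y → ∃[ e ] (ok e × crosses G A e ≡ true)
  Reach-crosses A here Ax≢Ax = ⊥-elim (Ax≢Ax refl)
  Reach-crosses A {x = x} (step {w = w} e o j r) Ax≢Ay with A x Bool.≟ A w
  ... | yes Ax≡Aw = Reach-crosses A r (Ax≢Ay ∘ trans Ax≡Aw)
  ... | no Ax≢Aw = e , o , crosses-Joins A j Ax≢Aw

  inBundle : Fin (E G) → Fin (E G) → Bool
  inBundle e g = ⌊ sameEnds? e g ⌋

  inBundle⁺ : ∀ {e g} → SameEnds G e g → inBundle e g ≡ true
  inBundle⁺ = Equivalence.to T-≡ ∘ fromWitness

  inBundle⁻ : ∀ {e g} → inBundle e g ≡ true → SameEnds G e g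
  inBundle⁻ = toWitness ∘ Equivalence.from T-≡

  between⁻ : ∀ {k} (f : Fin (V G) → Fin k) {t₁ t₂ e} → between G f t₁ t₂ e ≡ true →
             (f (end₁ e) ≡ t₁ × f (end₂ e) ≡ t₂) ⊎ (f (end₁ e) ≡ t₂ × f (end₂ e) ≡ t₁)
  between⁻ f {t₁} {t₂} {e} b with Equivalence.to T-∨ (Equivalence.from T-≡ b)
  ... | inj₁ both = let (p , q) = Equivalence.to T-∧ both in
        inj₁ (toWitness {a? = f (end₁ e) ≟ t₁} p , toWitness {a? = f (end₂ e) ≟ t₂} q)
  ... | inj₂ both = let (p , q) = Equivalence.to T-∧ both in
        inj₂ (toWitness {a? = f (end₁ e) ≟ t₂} p , toWitness {a? = f (end₂ e) ≟ t₁} q)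

  bundleSize : Fin (E G) → ℕ
  bundleSize e = length (filterᵇ (inBundle e) (allFin (E G)))

  AvoidsBundle : Fin (E G) → Pred (Fin (E G)) 0ℓ
  AvoidsBundle e g = ¬ SameEnds G e g

  Separated : Pred (Fin (E G)) 0ℓ
  Separated e = ¬ Reach G (AvoidsBundle e) (end₁ e) (end₂ e)

  Thin : Pred (Fin (E G)) 0ℓ
  Thin e = Separated e × bundleSize e ≤ 3

  thin? : Decidable Thin
  thin? e = ¬? (reach? (λ g → ¬? (sameEnds? e g)) (end₁ e) (end₂ e)) ×-dec (bundleSize e ≤? 3)

  Separated-Joins : ∀ {e x y} → Separated e → Joins G e x y → ¬ Reach G (AvoidsBundle e) x y
  Separated-Joins sep j r with Joins⁻ j
  ... | inj₁ (refl , refl) = sep r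
  ... | inj₂ (refl , refl) = sep (Reach-sym r)

  AvoidsBundle-resp : ∀ {e g h} → SameEnds G e g → AvoidsBundle e h → AvoidsBundle g h
  AvoidsBundle-resp e∥g e∦h g∥h = e∦h (SameEnds-trans e∥g g∥h)

  Thin-resp-SameEnds : ∀ {e g} → SameEnds G e g → Thin e → Thin g
  Thin-resp-SameEnds {e} {g} e∥g (sep , size≤3) =
    (λ r → Separated-Joins sep (Joins-resp-SameEnds (SameEnds-sym e∥g) (Joins-ends g))
                               (Reach-map (AvoidsBundle-resp (SameEnds-sym e∥g)) r)) ,
    ≤-trans (count-mono (inBundle g) (inBundle e) (λ h g∥h → inBundle⁺ (SameEnds-trans e∥g (inBundle⁻ g∥h)))) size≤3

  small-cut-crossing⇒Thin : NearlyFourEdgeConnected G → ∀ A → cutOrder G A < 4 →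
             ∀ {e} → crosses G A e ≡ true → Thin e
  small-cut-crossing⇒Thin nearly A cut<4 {e} e-crosses = separated , bundle≤cut
    where
    separated : Separated e
    separated r with Reach-crosses A r (xor≡true⇒≢ e-crosses)
    ... | g , e∦g , g-crosses = e∦g (proj₂ nearly A cut<4 e g e-crosses g-crosses)
    bundle≤cut : bundleSize e ≤ 3
    bundle≤cut = ≤-trans (count-mono (inBundle e) (crosses G A)
      (λ g e∥g → crosses-resp-SameEnds A (inBundle⁻ e∥g) e-crosses)) (≤-pred cut<4)

module Decomposition (G : Graph) where
  open Walks G
  open Bundles G
  open import Data.List.Membership.DecPropositional (_≟_ {E G}) using (_∈?_)

  SamePart : Rel (Fin (V G)) 0ℓ
  SamePart = Reach G (¬_ ∘ Thin)

  SamePart-isDecEquivalence : IsDecEquivalence SamePart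
  SamePart-isDecEquivalence = record
    { isEquivalence = record { refl = here ; sym = Reach-sym ; trans = Reach-trans }
    ; _≟_ = reach? {ok = ¬_ ∘ Thin} (¬? ∘ thin?)
    }

  module Parts = Transversal (transversal {P = λ _ → ⊤} (λ _ → yes tt) SamePart-isDecEquivalence)
  module TreeEdges = Transversal (transversal thin? SameEnds-isDecEquivalence)

  part : Fin (V G) → Fin Parts.size
  part x = Parts.index x tt

  part-≡⇒SamePart : ∀ {x y} → part x ≡ part y → SamePart x y
  part-≡⇒SamePart {x} {y} eq = Reach-trans (Parts.≈-rep-index x tt)
    (subst (λ t → SamePart (Parts.rep t) y) (sym eq) (Reach-sym (Parts.≈-rep-index y tt)))

  SamePart⇒part-≡ : ∀ {x y} → SamePart x y → part x ≡ part y
  SamePart⇒part-≡ {x} {y} x~y = Parts.rep-injective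
    (Reach-trans (Reach-sym (Parts.≈-rep-index x tt)) (Reach-trans x~y (Parts.≈-rep-index y tt)))

  part-rep : ∀ t → part (Parts.rep t) ≡ t
  part-rep t = Parts.rep-injective (Reach-sym (Parts.≈-rep-index (Parts.rep t) tt))

  T : Graph
  T = record
    { V = Parts.size
    ; E = TreeEdges.size
    ; ends = λ d → part (end₁ (TreeEdges.rep d)) , part (end₂ (TreeEdges.rep d))
    }

  SamePart-avoids : ∀ {g x y} → Thin g → SamePart x y → Reach G (AvoidsBundle g) x y
  SamePart-avoids thin = Reach-map (λ ¬thin g∥h → ¬thin (Thin-resp-SameEnds g∥h thin))

  Thin⇒part-≢ : ∀ {g x y} → Thin g → Joins G g x y → part x ≢ part y
  Thin⇒part-≢ thin j eq = Separated-Joins (proj₁ thin) j (SamePart-avoids thin (part-≡⇒SamePart eq))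

  part-≢⇒Thin : ∀ {g x y} → Joins G g x y → part x ≢ part y → Thin g
  part-≢⇒Thin {g} j x≁y with thin? g
  ... | yes thin = thin
  ... | no ¬thin = ⊥-elim (x≁y (SamePart⇒part-≡ (Reach-edge g ¬thin j)))

  lift-edge : ∀ {g e x x′ y′ y} → Thin g → AvoidsBundle g e → Joins G e x′ y′ →
              part x ≡ part x′ → part y′ ≡ part y → Reach G (AvoidsBundle g) x y
  lift-edge thin g∦e j x≈x′ y′≈y = Reach-trans (SamePart-avoids thin (part-≡⇒SamePart x≈x′))
    (step _ g∦e j (SamePart-avoids thin (part-≡⇒SamePart y′≈y)))

  Joins-T : ∀ d {x y} → Joins G (TreeEdges.rep d) x y → Joins T d (part x) (part y)
  Joins-T d j with Joins⁻ j
  ... | inj₁ (refl , refl) = inj₁ refl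
  ... | inj₂ (refl , refl) = inj₂ refl

  Joins-T⁻ : ∀ {d s t} → Joins T d s t →
             ∃[ x ] ∃[ y ] (Joins G (TreeEdges.rep d) x y × part x ≡ s × part y ≡ t)
  Joins-T⁻ {d} (inj₁ eq) = _ , _ , Joins-ends (TreeEdges.rep d) , cong proj₁ eq , cong proj₂ eq
  Joins-T⁻ {d} (inj₂ eq) = _ , _ , Joins-sym (Joins-ends (TreeEdges.rep d)) , cong proj₂ eq , cong proj₁ eq

  Joins-treeEdge : ∀ {g x y} (thin : Thin g) → Joins G g x y → Joins T (TreeEdges.index g thin) (part x) (part y)
  Joins-treeEdge {g} thin j = Joins-T (TreeEdges.index g thin) (Joins-resp-SameEnds (TreeEdges.≈-rep-index g thin) j)

  Reach-T : ∀ {x y} → Reach G (λ _ → ⊤) x y → Reach T (λ _ → ⊤) (part x) (part y)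
  Reach-T here = here
  Reach-T {x} (step {w = w} e _ j r) with part x ≟ part w
  ... | yes x≈w = subst (λ t → Reach T _ t _) (sym x≈w) (Reach-T r)
  ... | no x≁w = step _ tt (Joins-treeEdge (part-≢⇒Thin j x≁w) j) (Reach-T r)

  T-connected : Connected G → Connected T
  T-connected ((v , _) , reach) = (part v , tt) , λ s t _ _ →
    subst₂ (Reach T _) (part-rep s) (part-rep t) (Reach-T (reach (Parts.rep s) (Parts.rep t) tt tt))

  T-acyclic : ¬ Cycle T
  T-acyclic cycle with Joins-T⁻ (Cycle.close cycle)
  ... | x , y , j , x∈last , y∈first = Separated-Joins (proj₁ thin₀) (Joins-sym j) (along (fromℕ len) y∈first x∈last)
    where
    open Cycle cycle
    g₀ = TreeEdges.rep (es (fromℕ len))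
    thin₀ = TreeEdges.rep-P (es (fromℕ len))
    Along : Fin (suc len) → Set
    Along i = ∀ {x y} → part x ≡ vs zero → part y ≡ vs i → Reach G (AvoidsBundle g₀) x y
    avoids : ∀ i → AvoidsBundle g₀ (TreeEdges.rep (es (inject₁ i)))
    avoids i g₀∥ = fromℕ≢inject₁ (es-inj (TreeEdges.rep-injective {es (fromℕ len)} {es (inject₁ i)} g₀∥))
    extend : ∀ i → Along (inject₁ i) → Along (suc i)
    extend i along-i x∈first y∈next with Joins-T⁻ (consec i)
    ... | x′ , y′ , j′ , x′∈i , y′∈next =
          Reach-trans (along-i x∈first x′∈i) (lift-edge thin₀ (avoids i) j′ refl (trans y′∈next (sym y∈next)))
    along : ∀ i → Along i
    along = <-weakInduction Along
      (λ x∈first y∈first → SamePart-avoids thin₀ (part-≡⇒SamePart (trans x∈first (sym y∈first)))) extend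

  T-adjacent : ∀ e → part (end₁ e) ≢ part (end₂ e) → Adjacent T (part (end₁ e)) (part (end₂ e))
  T-adjacent e ends≁ = TreeEdges.index e thin , Joins-treeEdge thin (Joins-ends e)
    where
    thin = part-≢⇒Thin (Joins-ends e) ends≁

  between⇒SameEnds : ∀ d e → between G part (proj₁ (ends T d)) (proj₂ (ends T d)) e ≡ true →
                     SameEnds G (TreeEdges.rep d) e
  between⇒SameEnds d e e-between with sameEnds? (TreeEdges.rep d) e
  ... | yes g∥e = g∥e
  ... | no g∦e = ⊥-elim (proj₁ thin (walk (between⁻ part e-between)))
    where
    g = TreeEdges.rep d
    thin = TreeEdges.rep-P d
    walk : (part (end₁ e) ≡ part (end₁ g) × part (end₂ e) ≡ part (end₂ g)) ⊎
           (part (end₁ e) ≡ part (end₂ g) × part (end₂ e) ≡ part (end₁ g)) →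
           Reach G (AvoidsBundle g) (end₁ g) (end₂ g)
    walk (inj₁ (e₁∈g₁ , e₂∈g₂)) = lift-edge thin g∦e (Joins-ends e) (sym e₁∈g₁) e₂∈g₂
    walk (inj₂ (e₁∈g₂ , e₂∈g₁)) = lift-edge thin g∦e (Joins-sym (Joins-ends e)) (sym e₂∈g₁) e₁∈g₂

  T-edge-bundle : ∀ d →
    numBetween G part (proj₁ (ends T d)) (proj₂ (ends T d)) ≤ 3 ×
    (∀ e e′ → between G part (proj₁ (ends T d)) (proj₂ (ends T d)) e ≡ true
            → between G part (proj₁ (ends T d)) (proj₂ (ends T d)) e′ ≡ true
            → SameEnds G e e′)
  T-edge-bundle d =
    ≤-trans (count-mono _ (inBundle (TreeEdges.rep d)) (λ e e-between → inBundle⁺ (between⇒SameEnds d e e-between)))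
            (proj₂ (TreeEdges.rep-P d)) ,
    λ e e′ e-between e′-between →
      SameEnds-trans (SameEnds-sym (between⇒SameEnds d e e-between)) (between⇒SameEnds d e′ e′-between)

  module _ (nearly : NearlyFourEdgeConnected G) (t : Fin Parts.size)
           (S : List (Fin (E G))) (S<4 : length S < 4) where

    InPart : Pred (Fin (V G)) 0ℓ
    InPart x = part x ≡ t

    Kept : Pred (Fin (E G)) 0ℓ
    Kept e = InsideX G InPart e × ¬ e ∈ S

    kept? : Decidable Kept
    kept? e = ((part (end₁ e) ≟ t) ×-dec (part (end₂ e) ≟ t)) ×-dec ¬? (e ∈? S)

    Deleted : Fin (E G) → Fin (V G) → Fin (V G) → Set
    Deleted e x y = e ∈ S × InPart x × InPart y

    module _ {u v} (u∈t : InPart u) (v∈t : InPart v) (u↛v : ¬ Reach G Kept u v) where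

      KeptFromU : Pred (Fin (V G)) 0ℓ
      KeptFromU = Reach G Kept u

      HangsOff : Pred (Fin (V G)) 0ℓ
      HangsOff y = ∃[ e ] ∃[ a ] ∃[ b ]
        (Joins G e a b × Thin e × InPart a × KeptFromU a × Reach G (AvoidsBundle e) b y)

      Side : Pred (Fin (V G)) 0ℓ
      Side x = (InPart x × KeptFromU x) ⊎ (¬ InPart x × HangsOff x)

      side? : Decidable Side
      side? x = ((part x ≟ t) ×-dec reach? kept? u x) ⊎-dec (¬? (part x ≟ t) ×-dec hangsOff?)
        where
        hangsOff? : Dec (HangsOff x)
        hangsOff? = any? λ e → any? λ a → any? λ b →
          joins? e a b ×-dec thin? e ×-dec (part a ≟ t) ×-dec reach? kept? u a ×-dec
          reach? (λ g → ¬? (sameEnds? e g)) b x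

      side : Fin (V G) → Bool
      side x = ⌊ side? x ⌋

      inPart-step : ∀ {e x y} → Joins G e x y → ¬ Deleted e x y → InPart x → KeptFromU x → Side y
      inPart-step {e} {x} {y} j ¬deleted x∈t u→x with part y ≟ t
      ... | yes y∈t = inj₁ (y∈t , Reach-trans u→x (Reach-edge e kept j))
        where
        kept : Kept e
        kept = InsideX-Joins j x∈t y∈t , λ e∈S → ¬deleted (e∈S , x∈t , y∈t)
      ... | no y∉t = inj₂ (y∉t , e , x , y , j , part-≢⇒Thin j (λ x≈y → y∉t (trans (sym x≈y) x∈t)) , x∈t , u→x , here)

      hanging-step : ∀ {e x y} → Joins G e x y → ¬ InPart x → HangsOff x → Side y
      hanging-step {e} {x} {y} j x∉t (e′ , a , b , j′ , thin′ , a∈t , u→a , b→x) with sameEnds? e′ e | part y ≟ t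
      ... | yes e′∥e | _ = back-into-part (Joins-unique j (Joins-resp-SameEnds e′∥e j′))
        where
        back-into-part : (x ≡ a × y ≡ b) ⊎ (x ≡ b × y ≡ a) → Side y
        back-into-part (inj₁ (refl , _)) = ⊥-elim (x∉t a∈t)
        back-into-part (inj₂ (_ , refl)) = inj₁ (a∈t , u→a)
      ... | no e′∦e | yes y∈t = ⊥-elim (Separated-Joins (proj₁ thin′) (Joins-sym j′)
            (Reach-trans b→x (lift-edge thin′ e′∦e j refl (trans y∈t (sym a∈t)))))
      ... | no e′∦e | no y∉t = inj₂ (y∉t , e′ , a , b , j′ , thin′ , a∈t , u→a , Reach-trans b→x (Reach-edge e e′∦e j))

      Side-closed : ∀ {e x y} → Joins G e x y → ¬ Deleted e x y → Side x → Side y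
      Side-closed j ¬deleted (inj₁ (x∈t , u→x)) = inPart-step j ¬deleted x∈t u→x
      Side-closed j ¬deleted (inj₂ (x∉t , hangs)) = hanging-step j x∉t hangs

      side-≡ : ∀ {x y} → (Side x → Side y) → (Side y → Side x) → side x ≡ side y
      side-≡ {x} {y} to from = trans (isYes≗does (side? x))
        (trans (does-⇔ (mk⇔ to from) (side? x) (side? y)) (sym (isYes≗does (side? y))))

      crossing⇒Deleted : ∀ e → crosses G side e ≡ true → Deleted e (end₁ e) (end₂ e)
      crossing⇒Deleted e e-crosses =
        decidable-stable ((e ∈? S) ×-dec (part (end₁ e) ≟ t) ×-dec (part (end₂ e) ≟ t)) λ ¬deleted →
          xor≡true⇒≢ {side (end₁ e)} {side (end₂ e)} e-crosses (side-≡
            (Side-closed (Joins-ends e) ¬deleted)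
            (Side-closed (Joins-sym (Joins-ends e)) λ (e∈S , e₂∈t , e₁∈t) → ¬deleted (e∈S , e₁∈t , e₂∈t)))

      cut<4 : cutOrder G side < 4
      cut<4 = ≤-<-trans (count-≤ (crosses G side) (λ e e-crosses → proj₁ (crossing⇒Deleted e e-crosses))) S<4

      u-v-sides : side u ≢ side v
      u-v-sides eq = true≢false (trans (sym side-u) (trans eq side-v))
        where
        side-u : side u ≡ true
        side-u = trans (isYes≗does (side? u)) (dec-true (side? u) (inj₁ (u∈t , here)))
        v∉Side : ¬ Side v
        v∉Side (inj₁ (_ , u→v)) = u↛v u→v
        v∉Side (inj₂ (v∉t , _)) = v∉t v∈t
        side-v : side v ≡ false
        side-v = trans (isYes≗does (side? v)) (dec-false (side? v) v∉Side)
        true≢false : true ≢ false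
        true≢false ()

      separation-impossible : ⊥
      separation-impossible =
        let e , _ , e-crosses = Reach-crosses side (proj₂ (proj₁ nearly) u v tt tt) u-v-sides
            _ , e₁∈t , e₂∈t = crossing⇒Deleted e e-crosses
        in Thin⇒part-≢ (small-cut-crossing⇒Thin nearly side cut<4 e-crosses) (Joins-ends e) (trans e₁∈t (sym e₂∈t))

    part-connected : ∀ u v → InPart u → InPart v → Reach G Kept u v
    part-connected u v u∈t v∈t = decidable-stable (reach? kept? u v) (separation-impossible u∈t v∈t)

  part-shape : NearlyFourEdgeConnected G → ∀ t →
               SingleVertex G (λ v → part v ≡ t) ⊎ FourEdgeConnectedInduced G (λ v → part v ≡ t)
  part-shape nearly t = shape (any? λ v → (part v ≟ t) ×-dec ¬? (v ≟ Parts.rep t))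
    where
    shape : Dec (∃[ v ] (part v ≡ t × v ≢ Parts.rep t)) →
            SingleVertex G (λ v → part v ≡ t) ⊎ FourEdgeConnectedInduced G (λ v → part v ≡ t)
    shape (no onlyRep) = inj₁ (Parts.rep t , λ u →
      (λ u∈t → decidable-stable (u ≟ Parts.rep t) (λ u≢rep → onlyRep (u , u∈t , u≢rep))) ,
      λ { refl → part-rep t })
    shape (yes (v , v∈t , v≢rep)) = inj₂ ((Parts.rep t , v , v≢rep ∘ sym , part-rep t , v∈t) ,
      λ S S<4 → (Parts.rep t , part-rep t) , part-connected nearly t S S<4)

lemma5p1 : (G : Graph) → NearlyFourEdgeConnected G →
    ∃[ T ] ∃[ f ] (IsTree T × TreePartition G T f)
lemma5p1 G nearly =
  T , part , (T-connected (proj₁ nearly) , T-acyclic) , part-shape nearly , T-adjacent , T-edge-bundle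
  where
  open Decomposition G
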